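{- Let $h$ be a positive integer and let $f=\{f_0,\dots,f_h\}$ be a symmetric, even pebbling configuration on the complete binary tree $T^h$. If $f$ pebbles $T^h$, then \[ 3n(f)-c(f)\ge 2^{h+1}, \] where $n(f)=\sum_{i=0}^h 2^if_i$ and $c(f)=\sum_{i=0}^h f_i$.
   Context: $T^h$ is the complete binary tree of height $h$ (each non-leaf vertex has two children, all leaves at distance $h$ from the root); level $i$ consists of the $2^i$ vertices at distance $i$ from the root. A pebbling configuration assigns a nonnegative integer number of pebbles to each vertex. It is symmetric if all vertices of the same level carry the same number of pebbles, written $\{f_0,\dots,f_h\}$ with $f_i$ the number at each vertex of level $i$; it is even if every non-root vertex carries an even number of pebbles. A pebbling move removes two pebbles from a vertex and places one pebble on an adjacent vertex; $f$ pebbles $T^h$ if every vertex can receive a pebble through some sequence of pebbling moves. -}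

module Defs where

open import Data.Nat using (ℕ; zero; suc; _+_; _*_; _∸_; _^_; _≤_; _<_; s≤s)
open import Data.Nat.Divisibility using (_∣_)
open import Data.Bool using (Bool; if_then_else_)
open import Data.List using (List; []; _∷_; length)
open import Data.List.Properties using (≡-dec)
open import Data.Bool.Properties using () renaming (_≟_ to _≟B_)
open import Data.Fin using (Fin; toℕ; fromℕ<)
open import Data.Vec using (Vec; tabulate; sum)
open import Data.Product using (Σ; ∃; _×_; _,_)
open import Data.Sum using (_⊎_)
open import Relation.Nullary using (¬_)
open import Relation.Nullary.Decidable using (⌊_⌋)
open import Relation.Binary.PropositionalEquality using (_≡_)
open import Relation.Binary.Construct.Closure.ReflexiveTransitive using (Star)

-- Vertices of the complete binary tree T^h: a vertex is the path from the
-- root, recorded as a list of left/right choices (the most recent choice is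
-- the head of the list), of length at most h.
record Vertex (h : ℕ) : Set where
  constructor vtx
  field
    path  : List Bool
    depth : length path ≤ h
open Vertex public

level : ∀ {h} → Vertex h → Fin (suc h)
level v = fromℕ< (s≤s (depth v))

ChildOf : ∀ {h} → Vertex h → Vertex h → Set
ChildOf v u = Σ Bool λ b → path v ≡ b ∷ path u

Adjacent : ∀ {h} → Vertex h → Vertex h → Set
Adjacent u v = ChildOf v u ⊎ ChildOf u v

Config : ℕ → Set
Config h = Vertex h → ℕ

[_≟_] : ∀ {h} → Vertex h → Vertex h → Bool
[ w ≟ u ] = ⌊ ≡-dec _≟B_ (path w) (path u) ⌋

move : ∀ {h} → Config h → Vertex h → Vertex h → Config h
move c u v w =
  (c w ∸ (if [ w ≟ u ] then 2 else 0)) + (if [ w ≟ v ] then 1 else 0)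

PebblingMove : ∀ {h} → Config h → Config h → Set
PebblingMove {h} c c' =
  Σ (Vertex h) λ u → Σ (Vertex h) λ v →
    Adjacent u v × 2 ≤ c u × (∀ w → c' w ≡ move c u v w)

Reachable : ∀ {h} → Config h → Config h → Set
Reachable = Star PebblingMove

Pebbles : ∀ {h} → Config h → Set
Pebbles {h} c = ∀ (t : Vertex h) → ∃ λ c' → Reachable c c' × 1 ≤ c' t

symConfig : ∀ {h} → (Fin (suc h) → ℕ) → Config h
symConfig f v = f (level v)

-- even: every non-root vertex has an even number of pebbles,
-- i.e. f_i is even for every level i ≥ 1
EvenSym : ∀ {h} → (Fin (suc h) → ℕ) → Set
EvenSym {h} f = ∀ (i : Fin (suc h)) → ¬ (toℕ i ≡ 0) → 2 ∣ f i

-- n(f) = Σ 2^i f_i  (total number of pebbles)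
nPeb : ∀ {h} → (Fin (suc h) → ℕ) → ℕ
nPeb f = sum (tabulate λ i → 2 ^ toℕ i * f i)

cPeb : ∀ {h} → (Fin (suc h) → ℕ) → ℕ
cPeb f = sum (tabulate f)

-- Give each vertex at distance d from the leftmost leaf ℓ of T^h the weight
-- 4^h / 2^d.  A pebbling move spends two pebbles on u to put one on a neighbour
-- of u, whose weight is at most twice that of u, so the weighted pebble count
-- never increases; once ℓ carries a pebble it is at least 4^h.  For a symmetric
-- configuration the weighted count, computed level by level along the path to
-- ℓ, is 2^(h-1) (3 n(f) - c(f)), which gives the bound.
module Submission where

open import Defs
open import Data.Bool using (Bool; true; false; if_then_else_)
open import Data.Bool.Properties using () renaming (_≟_ to _≟B_)
open import Data.Empty using (⊥-elim)
open import Data.Fin using (Fin; toℕ; fromℕ<) renaming (zero to fzero; suc to fsuc)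
open import Data.Fin.Properties using (fromℕ<-cong)
open import Data.List using (List; []; _∷_; length; reverse; _∷ʳ_; replicate)
open import Data.List.Properties
  using (≡-dec; ∷-injectiveʳ; length-reverse; reverse-involutive; unfold-reverse; length-replicate)
open import Data.Nat using (ℕ; zero; suc; _+_; _∸_; _*_; _^_; _≤_; _<_; z≤n; s≤s; s≤s⁻¹; _≤?_)
open import Data.Nat.Properties
open import Data.Nat.Tactic.RingSolver using (solve-∀)
open import Data.Product using (_,_)
open import Data.Sum using (inj₁; inj₂)
open import Data.Vec using (tabulate; sum)
open import Data.Vec.Properties using (tabulate-cong)
open import Function using (_∘_)
open import Relation.Nullary using (¬_; yes; no)
open import Relation.Nullary.Decidable using (isYes≗does; dec-true; dec-false)
open import Relation.Binary.PropositionalEquality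
  using (_≡_; _≢_; refl; sym; trans; cong; cong₂; subst; module ≡-Reasoning)
open import Relation.Binary.Construct.Closure.ReflexiveTransitive using (ε; _◅_)

length-∷ʳ : ∀ {A : Set} (xs : List A) x → length (xs ∷ʳ x) ≡ suc (length xs)
length-∷ʳ []       x = refl
length-∷ʳ (_ ∷ xs) x = cong suc (length-∷ʳ xs x)

m<n⇒n∸m≡1+[n∸1+m] : ∀ {m n} → m < n → n ∸ m ≡ suc (n ∸ suc m)
m<n⇒n∸m≡1+[n∸1+m] {zero}  (s≤s _)   = refl
m<n⇒n∸m≡1+[n∸1+m] {suc m} (s≤s m<n) = m<n⇒n∸m≡1+[n∸1+m] m<n

^-distribʳ-* : ∀ m n o → (m * n) ^ o ≡ m ^ o * n ^ o
^-distribʳ-* m n zero    = refl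
^-distribʳ-* m n (suc o) = trans (cong (m * n *_) (^-distribʳ-* m n o)) (shuffle m n (m ^ o) (n ^ o))
  where
  shuffle : ∀ m n x y → m * n * (x * y) ≡ m * x * (n * y)
  shuffle = solve-∀

m∸n+o+n≡m+o : ∀ {m n} o → n ≤ m → m ∸ n + o + n ≡ m + o
m∸n+o+n≡m+o {m} {n} o n≤m = begin
  m ∸ n + o + n   ≡⟨ +-assoc (m ∸ n) o n ⟩
  m ∸ n + (o + n) ≡⟨ cong (m ∸ n +_) (+-comm o n) ⟩
  m ∸ n + (n + o) ≡⟨ sym (+-assoc (m ∸ n) n o) ⟩
  m ∸ n + n + o   ≡⟨ cong (_+ o) (m∸n+n≡m n≤m) ⟩
  m + o ∎
  where open ≡-Reasoning

sum-tabulate-* : ∀ {n} k (g : Fin n → ℕ) → sum (tabulate (λ i → k * g i)) ≡ k * sum (tabulate g)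
sum-tabulate-* {zero}  k g = sym (*-zeroʳ k)
sum-tabulate-* {suc n} k g =
  trans (cong (k * g fzero +_) (sum-tabulate-* k (g ∘ fsuc))) (sym (*-distribˡ-+ k _ _))

nPeb-suc : ∀ {r} (φ : Fin (suc (suc r)) → ℕ) → nPeb φ ≡ φ fzero + 2 * nPeb (φ ∘ fsuc)
nPeb-suc φ = cong₂ _+_ (*-identityˡ (φ fzero))
  (trans (cong sum (tabulate-cong λ i → *-assoc 2 (2 ^ toℕ i) (φ (fsuc i))))
         (sum-tabulate-* 2 (λ i → 2 ^ toℕ i * φ (fsuc i))))

-- Sums over the vertices of T^r, indexed by root-first paths.
treeSum : ℕ → (List Bool → ℕ) → ℕ
treeSum zero    g = g []
treeSum (suc r) g = g [] + treeSum r (λ σ → g (false ∷ σ)) + treeSum r (λ σ → g (true ∷ σ))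

treeSum-cong : ∀ r {g g′ : List Bool → ℕ} → (∀ σ → g σ ≡ g′ σ) → treeSum r g ≡ treeSum r g′
treeSum-cong zero    g≗g′ = g≗g′ []
treeSum-cong (suc r) g≗g′ =
  cong₂ _+_ (cong₂ _+_ (g≗g′ []) (treeSum-cong r (g≗g′ ∘ (false ∷_))))
            (treeSum-cong r (g≗g′ ∘ (true ∷_)))

treeSum-+ : ∀ r (g g′ : List Bool → ℕ) → treeSum r (λ σ → g σ + g′ σ) ≡ treeSum r g + treeSum r g′
treeSum-+ zero    g g′ = refl
treeSum-+ (suc r) g g′
  rewrite treeSum-+ r (λ σ → g (false ∷ σ)) (λ σ → g′ (false ∷ σ))
        | treeSum-+ r (λ σ → g (true ∷ σ)) (λ σ → g′ (true ∷ σ)) = regroup (g []) (g′ []) _ _ _ _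
  where
  regroup : ∀ a a′ b b′ c c′ → a + a′ + (b + b′) + (c + c′) ≡ a + b + c + (a′ + b′ + c′)
  regroup = solve-∀

treeSum-* : ∀ r k (g : List Bool → ℕ) → treeSum r (λ σ → k * g σ) ≡ k * treeSum r g
treeSum-* zero    k g = refl
treeSum-* (suc r) k g
  rewrite treeSum-* r k (λ σ → g (false ∷ σ))
        | treeSum-* r k (λ σ → g (true ∷ σ)) = sym (*-distribˡ-+³ k (g []) _ _)
  where
  *-distribˡ-+³ : ∀ k a b c → k * (a + b + c) ≡ k * a + k * b + k * c
  *-distribˡ-+³ = solve-∀

treeSum-zero : ∀ r (g : List Bool → ℕ) → (∀ σ → g σ ≡ 0) → treeSum r g ≡ 0
treeSum-zero r g g≗0 = trans (treeSum-cong r g≗0) (treeSum-* r 0 g)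

treeSum-single : ∀ r ρ (g : List Bool → ℕ) → length ρ ≤ r →
  (∀ σ → σ ≢ ρ → g σ ≡ 0) → treeSum r g ≡ g ρ
treeSum-single zero [] g _ _ = refl
treeSum-single (suc r) [] g _ off
  rewrite treeSum-zero r _ (λ σ → off (false ∷ σ) λ ())
        | treeSum-zero r _ (λ σ → off (true ∷ σ) λ ()) = trans (+-identityʳ _) (+-identityʳ _)
treeSum-single (suc r) (false ∷ ρ) g (s≤s ρ≤r) off
  rewrite off [] (λ ())
        | treeSum-zero r _ (λ σ → off (true ∷ σ) λ ())
        | treeSum-single r ρ _ ρ≤r (λ σ σ≢ρ → off (false ∷ σ) (σ≢ρ ∘ ∷-injectiveʳ)) = +-identityʳ _
treeSum-single (suc r) (true ∷ ρ) g (s≤s ρ≤r) off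
  rewrite off [] (λ ())
        | treeSum-zero r _ (λ σ → off (false ∷ σ) λ ())
        | treeSum-single r ρ _ ρ≤r (λ σ σ≢ρ → off (true ∷ σ) (σ≢ρ ∘ ∷-injectiveʳ)) = refl

term≤treeSum : ∀ r ρ (g : List Bool → ℕ) → length ρ ≤ r → g ρ ≤ treeSum r g
term≤treeSum zero [] g _ = ≤-refl
term≤treeSum (suc r) [] g _ = ≤-trans (m≤m+n _ _) (m≤m+n _ _)
term≤treeSum (suc r) (false ∷ ρ) g (s≤s ρ≤r) =
  ≤-trans (term≤treeSum r ρ _ ρ≤r) (≤-trans (m≤n+m _ (g [])) (m≤m+n _ _))
term≤treeSum (suc r) (true ∷ ρ) g (s≤s ρ≤r) =
  ≤-trans (term≤treeSum r ρ _ ρ≤r) (m≤n+m _ _)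

extend : (r : ℕ) → ((σ : List Bool) → length σ ≤ r → ℕ) → List Bool → ℕ
extend r F σ with length σ ≤? r
... | yes σ≤r = F σ σ≤r
... | no  _   = 0

extend-≤ : ∀ r F σ (σ≤r : length σ ≤ r) → extend r F σ ≡ F σ σ≤r
extend-≤ r F σ σ≤r with length σ ≤? r
... | yes σ≤r′ = cong (F σ) (≤-irrelevant σ≤r′ σ≤r)
... | no  σ≰r  = ⊥-elim (σ≰r σ≤r)

extend-≰ : ∀ r F σ → ¬ length σ ≤ r → extend r F σ ≡ 0
extend-≰ r F σ σ≰r with length σ ≤? r
... | yes σ≤r = ⊥-elim (σ≰r σ≤r)
... | no  _   = refl

extend-cong : ∀ r {F G} → (∀ σ σ≤r → F σ σ≤r ≡ G σ σ≤r) → ∀ σ → extend r F σ ≡ extend r G σ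
extend-cong r F≗G σ with length σ ≤? r
... | yes σ≤r = F≗G σ σ≤r
... | no  _   = refl

extend-+ : ∀ r F G σ → extend r (λ τ τ≤r → F τ τ≤r + G τ τ≤r) σ ≡ extend r F σ + extend r G σ
extend-+ r F G σ with length σ ≤? r
... | yes _ = refl
... | no  _ = refl

extend-∷ : ∀ r F b σ → extend (suc r) F (b ∷ σ) ≡ extend r (λ τ τ≤r → F (b ∷ τ) (s≤s τ≤r)) σ
extend-∷ r F b σ with length σ ≤? r
... | yes σ≤r = extend-≤ (suc r) F (b ∷ σ) (s≤s σ≤r)
... | no  σ≰r = extend-≰ (suc r) F (b ∷ σ) (σ≰r ∘ s≤s⁻¹)

onLevels : (r : ℕ) → (Fin (suc r) → ℕ) → List Bool → ℕ
onLevels r φ = extend r (λ σ σ≤r → φ (fromℕ< (s≤s σ≤r)))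

onLevels-∷ : ∀ r φ b σ → onLevels (suc r) φ (b ∷ σ) ≡ onLevels r (φ ∘ fsuc) σ
onLevels-∷ r φ = extend-∷ r _

treeSum-levels : ∀ r φ → treeSum r (λ σ → 2 ^ (r ∸ length σ) * onLevels r φ σ) ≡ 2 ^ r * cPeb φ
treeSum-levels zero    φ = cong (1 *_) (sym (+-identityʳ (φ fzero)))
treeSum-levels (suc r) φ =
  trans (cong₂ (λ a b → 2 ^ suc r * φ fzero + a + b) (subtree false) (subtree true))
        (combine (2 ^ r) (φ fzero) (cPeb (φ ∘ fsuc)))
  where
  subtree : ∀ b → treeSum r (λ σ → 2 ^ (r ∸ length σ) * onLevels (suc r) φ (b ∷ σ))
                  ≡ 2 ^ r * cPeb (φ ∘ fsuc)
  subtree b = trans (treeSum-cong r λ σ → cong (2 ^ (r ∸ length σ) *_) (onLevels-∷ r φ b σ))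
                    (treeSum-levels r (φ ∘ fsuc))
  combine : ∀ P a C → 2 * P * a + P * C + P * C ≡ 2 * P * (a + C)
  combine = solve-∀

leadingFalses : List Bool → ℕ
leadingFalses []          = 0
leadingFalses (false ∷ σ) = suc (leadingFalses σ)
leadingFalses (true  ∷ σ) = 0

leadingFalses-∷ʳ-≤ : ∀ σ b → leadingFalses (σ ∷ʳ b) ≤ suc (leadingFalses σ)
leadingFalses-∷ʳ-≤ []          false = ≤-refl
leadingFalses-∷ʳ-≤ []          true  = z≤n
leadingFalses-∷ʳ-≤ (false ∷ σ) b     = s≤s (leadingFalses-∷ʳ-≤ σ b)
leadingFalses-∷ʳ-≤ (true  ∷ σ) b     = z≤n

leadingFalses-≤-∷ʳ : ∀ σ b → leadingFalses σ ≤ leadingFalses (σ ∷ʳ b)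
leadingFalses-≤-∷ʳ []          b = z≤n
leadingFalses-≤-∷ʳ (false ∷ σ) b = s≤s (leadingFalses-≤-∷ʳ σ b)
leadingFalses-≤-∷ʳ (true  ∷ σ) b = z≤n

leadingFalses-replicate : ∀ n → leadingFalses (replicate n false) ≡ n
leadingFalses-replicate zero    = refl
leadingFalses-replicate (suc n) = cong suc (leadingFalses-replicate n)

-- For a vertex σ of T^r this is 4^r / 2^d, d being the distance from σ to the
-- leftmost leaf: σ leaves the leftmost path at depth ℓ = leadingFalses σ, so
-- d = (length σ - ℓ) + (r - ℓ).
weight : ℕ → List Bool → ℕ
weight r σ = 2 ^ (r ∸ length σ) * 4 ^ leadingFalses σ

weight-parent : ∀ r σ b → length (σ ∷ʳ b) ≤ r →
  weight r σ ≡ 2 * (2 ^ (r ∸ length (σ ∷ʳ b)) * 4 ^ leadingFalses σ)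
weight-parent r σ b σb≤r = begin
  2 ^ (r ∸ length σ) * 4 ^ leadingFalses σ
    ≡⟨ cong (λ e → 2 ^ e * 4 ^ leadingFalses σ) r∸σ ⟩
  2 * 2 ^ (r ∸ length (σ ∷ʳ b)) * 4 ^ leadingFalses σ
    ≡⟨ *-assoc 2 (2 ^ (r ∸ length (σ ∷ʳ b))) (4 ^ leadingFalses σ) ⟩
  2 * (2 ^ (r ∸ length (σ ∷ʳ b)) * 4 ^ leadingFalses σ) ∎
  where
  open ≡-Reasoning
  r∸σ : r ∸ length σ ≡ suc (r ∸ length (σ ∷ʳ b))
  r∸σ = trans (m<n⇒n∸m≡1+[n∸1+m] (subst (_≤ r) (length-∷ʳ σ b) σb≤r))
              (cong (λ n → suc (r ∸ n)) (sym (length-∷ʳ σ b)))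

weight-child-≤ : ∀ r σ b → length (σ ∷ʳ b) ≤ r → weight r (σ ∷ʳ b) ≤ 2 * weight r σ
weight-child-≤ r σ b σb≤r = begin
  2 ^ A * 4 ^ leadingFalses (σ ∷ʳ b) ≤⟨ *-monoʳ-≤ (2 ^ A) (^-monoʳ-≤ 4 (leadingFalses-∷ʳ-≤ σ b)) ⟩
  2 ^ A * (4 * 4 ^ leadingFalses σ)   ≡⟨ shuffle (2 ^ A) (4 ^ leadingFalses σ) ⟩
  2 * (2 * (2 ^ A * 4 ^ leadingFalses σ)) ≡⟨ cong (2 *_) (sym (weight-parent r σ b σb≤r)) ⟩
  2 * weight r σ ∎
  where
  open ≤-Reasoning
  A = r ∸ length (σ ∷ʳ b)
  shuffle : ∀ x y → x * (4 * y) ≡ 2 * (2 * (x * y))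
  shuffle = solve-∀

weight-parent-≤ : ∀ r σ b → length (σ ∷ʳ b) ≤ r → weight r σ ≤ 2 * weight r (σ ∷ʳ b)
weight-parent-≤ r σ b σb≤r = begin
  weight r σ                                              ≡⟨ weight-parent r σ b σb≤r ⟩
  2 * (2 ^ A * 4 ^ leadingFalses σ)                       ≤⟨ *-monoʳ-≤ 2 (*-monoʳ-≤ (2 ^ A)
                                                               (^-monoʳ-≤ 4 (leadingFalses-≤-∷ʳ σ b))) ⟩
  2 * weight r (σ ∷ʳ b) ∎
  where
  open ≤-Reasoning
  A = r ∸ length (σ ∷ʳ b)

treeSum-weight : ∀ r φ →
  2 * treeSum r (λ σ → weight r σ * onLevels r φ σ) + 2 ^ r * cPeb φ ≡ 3 * 2 ^ r * nPeb φ
treeSum-weight zero    φ = base (φ fzero)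
  where
  base : ∀ a → 2 * (1 * 1 * a) + 1 * (a + 0) ≡ 3 * 1 * (1 * a + 0)
  base = solve-∀
treeSum-weight (suc r) φ = begin
  2 * (2 ^ suc r * 1 * φ fzero + leftSubtree + rightSubtree) + 2 ^ suc r * cPeb φ
    ≡⟨ cong₂ (λ a b → 2 * (2 * P * 1 * φ fzero + a + b) + 2 * P * cPeb φ) left right ⟩
  2 * (2 * P * 1 * φ fzero + 4 * T′ + P * C′) + 2 * P * (φ fzero + C′)
    ≡⟨ regroup P (φ fzero) T′ C′ ⟩
  6 * P * φ fzero + 4 * (2 * T′ + P * C′)
    ≡⟨ cong (λ x → 6 * P * φ fzero + 4 * x) (treeSum-weight r φ′) ⟩
  6 * P * φ fzero + 4 * (3 * P * N′)
    ≡⟨ factor P (φ fzero) N′ ⟩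
  3 * (2 * P) * (φ fzero + 2 * N′)
    ≡⟨ cong (3 * (2 * P) *_) (sym (nPeb-suc φ)) ⟩
  3 * 2 ^ suc r * nPeb φ ∎
  where
  open ≡-Reasoning
  P  = 2 ^ r
  φ′ = φ ∘ fsuc
  C′ = cPeb φ′
  N′ = nPeb φ′
  T′ = treeSum r (λ σ → weight r σ * onLevels r φ′ σ)
  leftSubtree  = treeSum r (λ σ → weight (suc r) (false ∷ σ) * onLevels (suc r) φ (false ∷ σ))
  rightSubtree = treeSum r (λ σ → weight (suc r) (true ∷ σ) * onLevels (suc r) φ (true ∷ σ))
  pull4 : ∀ x y z → x * (4 * y) * z ≡ 4 * (x * y * z)
  pull4 = solve-∀
  regroup : ∀ P a T C → 2 * (2 * P * 1 * a + 4 * T + P * C) + 2 * P * (a + C)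
                        ≡ 6 * P * a + 4 * (2 * T + P * C)
  regroup = solve-∀
  factor : ∀ P a N → 6 * P * a + 4 * (3 * P * N) ≡ 3 * (2 * P) * (a + 2 * N)
  factor = solve-∀
  left : leftSubtree ≡ 4 * T′
  left = trans (treeSum-cong r λ σ →
                  trans (cong (weight (suc r) (false ∷ σ) *_) (onLevels-∷ r φ false σ))
                        (pull4 (2 ^ (r ∸ length σ)) (4 ^ leadingFalses σ) _))
               (treeSum-* r 4 _)
  right : rightSubtree ≡ P * C′
  right = trans (treeSum-cong r λ σ →
                   trans (cong (weight (suc r) (true ∷ σ) *_) (onLevels-∷ r φ true σ))
                         (cong (_* onLevels r φ′ σ) (*-identityʳ (2 ^ (r ∸ length σ)))))
                (treeSum-levels r φ′)

module Potential (h : ℕ) where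

  -- Vertex paths are stored leaf-first, whereas treeSum indexes them root-first.
  vertexAt : (σ : List Bool) → length σ ≤ h → Vertex h
  vertexAt σ σ≤h = vtx (reverse σ) (subst (_≤ h) (sym (length-reverse σ)) σ≤h)

  valueAt : Config h → List Bool → ℕ
  valueAt c = extend h (λ σ σ≤h → c (vertexAt σ σ≤h))

  potential : Config h → ℕ
  potential c = treeSum h (λ σ → weight h σ * valueAt c σ)

  potential-cong : ∀ {c c′ : Config h} → (∀ w → c w ≡ c′ w) → potential c ≡ potential c′
  potential-cong c≗c′ =
    treeSum-cong h λ σ → cong (weight h σ *_) (extend-cong h (λ τ τ≤h → c≗c′ (vertexAt τ τ≤h)) σ)

  potential-+ : ∀ (c c′ : Config h) → potential (λ w → c w + c′ w) ≡ potential c + potential c′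
  potential-+ c c′ = trans
    (treeSum-cong h λ σ → trans (cong (weight h σ *_) (extend-+ h _ _ σ)) (*-distribˡ-+ (weight h σ) _ _))
    (treeSum-+ h _ _)

  path-injective : ∀ {v w : Vertex h} → path v ≡ path w → v ≡ w
  path-injective {vtx p p≤h} {vtx .p p≤h′} refl = cong (vtx p) (≤-irrelevant p≤h p≤h′)

  -- move c u v w is definitionally (c w ∸ indicator u 2 w) + indicator v 1 w.
  indicator : Vertex h → ℕ → Config h
  indicator u k w = if [ w ≟ u ] then k else 0

  indicator-≡ : ∀ u k w → path w ≡ path u → indicator u k w ≡ k
  indicator-≡ u k w eq = cong (if_then k else 0) (trans (isYes≗does w≟u) (dec-true w≟u eq))
    where w≟u = ≡-dec _≟B_ (path w) (path u)

  indicator-≢ : ∀ u k w → path w ≢ path u → indicator u k w ≡ 0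
  indicator-≢ u k w neq = cong (if_then k else 0) (trans (isYes≗does w≟u) (dec-false w≟u neq))
    where w≟u = ≡-dec _≟B_ (path w) (path u)

  indicator-≤ : ∀ (c : Config h) u k → k ≤ c u → ∀ w → indicator u k w ≤ c w
  indicator-≤ c u k k≤cu w with ≡-dec _≟B_ (path w) (path u)
  ... | yes eq = subst (k ≤_) (cong c (path-injective (sym eq))) k≤cu
  ... | no  _  = z≤n

  potential-indicator : ∀ u k → potential (indicator u k) ≡ weight h (reverse (path u)) * k
  potential-indicator u k =
    trans (treeSum-single h ρ _ ρ≤h off)
          (cong (weight h ρ *_) (trans (extend-≤ h _ ρ ρ≤h)
                                       (indicator-≡ u k (vertexAt ρ ρ≤h) (reverse-involutive (path u)))))
    where
    ρ = reverse (path u)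
    ρ≤h : length ρ ≤ h
    ρ≤h = subst (_≤ h) (sym (length-reverse (path u))) (depth u)
    off : ∀ σ → σ ≢ ρ → weight h σ * valueAt (indicator u k) σ ≡ 0
    off σ σ≢ρ with length σ ≤? h
    ... | yes σ≤h = trans (cong (weight h σ *_) (indicator-≢ u k (vertexAt σ σ≤h) λ eq →
                    σ≢ρ (trans (sym (reverse-involutive σ)) (cong reverse eq))))
                    (*-zeroʳ (weight h σ))
    ... | no  _   = *-zeroʳ (weight h σ)

  reverse-child : ∀ (v u : Vertex h) b → path v ≡ b ∷ path u → reverse (path v) ≡ reverse (path u) ∷ʳ b
  reverse-child v u b v≺u = trans (cong reverse v≺u) (unfold-reverse b (path u))

  child-depth : ∀ (v u : Vertex h) b → path v ≡ b ∷ path u → length (reverse (path u) ∷ʳ b) ≤ h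
  child-depth v u b v≺u =
    subst (_≤ h) (trans (sym (length-reverse (path v))) (cong length (reverse-child v u b v≺u))) (depth v)

  weight-adjacent : ∀ (u v : Vertex h) → Adjacent u v →
    weight h (reverse (path v)) ≤ 2 * weight h (reverse (path u))
  weight-adjacent u v (inj₁ (b , v≺u)) =
    subst (λ ρ → weight h ρ ≤ 2 * weight h (reverse (path u))) (sym (reverse-child v u b v≺u))
          (weight-child-≤ h (reverse (path u)) b (child-depth v u b v≺u))
  weight-adjacent u v (inj₂ (b , u≺v)) =
    subst (λ ρ → weight h (reverse (path v)) ≤ 2 * weight h ρ) (sym (reverse-child u v b u≺v))
          (weight-parent-≤ h (reverse (path v)) b (child-depth u v b u≺v))

  potential-move : ∀ {c c′} → PebblingMove c c′ → potential c′ ≤ potential c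
  potential-move {c} {c′} (u , v , u~v , 2≤cu , c′≡move) = +-cancelʳ-≤ (wᵤ * 2) _ _ (begin
    potential c′ + wᵤ * 2                        ≡⟨ cong (potential c′ +_) (sym (potential-indicator u 2)) ⟩
    potential c′ + potential (indicator u 2)     ≡⟨ sym (potential-+ c′ (indicator u 2)) ⟩
    potential (λ w → c′ w + indicator u 2 w)     ≡⟨ potential-cong balance ⟩
    potential (λ w → c w + indicator v 1 w)      ≡⟨ potential-+ c (indicator v 1) ⟩
    potential c + potential (indicator v 1)      ≡⟨ cong (potential c +_) (potential-indicator v 1) ⟩
    potential c + wᵥ * 1                         ≡⟨ cong (potential c +_) (*-identityʳ wᵥ) ⟩
    potential c + wᵥ                             ≤⟨ +-monoʳ-≤ (potential c) (weight-adjacent u v u~v) ⟩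
    potential c + 2 * wᵤ                         ≡⟨ cong (potential c +_) (*-comm 2 wᵤ) ⟩
    potential c + wᵤ * 2                         ∎)
    where
    open ≤-Reasoning
    wᵤ = weight h (reverse (path u))
    wᵥ = weight h (reverse (path v))
    balance : ∀ w → c′ w + indicator u 2 w ≡ c w + indicator v 1 w
    balance w = trans (cong (_+ indicator u 2 w) (c′≡move w))
                      (m∸n+o+n≡m+o (indicator v 1 w) (indicator-≤ c u 2 2≤cu w))

  potential-reachable : ∀ {c c′} → Reachable c c′ → potential c′ ≤ potential c
  potential-reachable ε              = ≤-refl
  potential-reachable (step ◅ steps) = ≤-trans (potential-reachable steps) (potential-move step)

  potential-symConfig : ∀ f → 2 * potential (symConfig f) + 2 ^ h * cPeb f ≡ 3 * 2 ^ h * nPeb f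
  potential-symConfig f = trans
    (cong (λ x → 2 * x + 2 ^ h * cPeb f) (treeSum-cong h λ σ → cong (weight h σ *_)
      (extend-cong h (λ σ σ≤h → cong f (fromℕ<-cong _ _ (length-reverse σ) _ _)) σ)))
    (treeSum-weight h f)

  leftmostLeaf : Vertex h
  leftmostLeaf = vertexAt (replicate h false) (≤-reflexive (length-replicate h))

  potential-leftmostLeaf : ∀ c → 1 ≤ c leftmostLeaf → 4 ^ h ≤ potential c
  potential-leftmostLeaf c 1≤cℓ = begin
    4 ^ h                    ≡⟨ sym (trans (*-identityʳ (weight h ℓ)) weight-ℓ) ⟩
    weight h ℓ * 1           ≤⟨ *-monoʳ-≤ (weight h ℓ) (subst (1 ≤_) (sym (extend-≤ h _ ℓ ℓ≤h)) 1≤cℓ) ⟩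
    weight h ℓ * valueAt c ℓ ≤⟨ term≤treeSum h ℓ _ ℓ≤h ⟩
    potential c              ∎
    where
    open ≤-Reasoning
    ℓ = replicate h false
    ℓ≤h = ≤-reflexive (length-replicate h)
    weight-ℓ : weight h ℓ ≡ 4 ^ h
    weight-ℓ = trans (cong₂ (λ a b → 2 ^ a * 4 ^ b) (trans (cong (h ∸_) (length-replicate h)) (n∸n≡0 h))
                                                  (leadingFalses-replicate h))
                     (*-identityˡ (4 ^ h))

  pebbling-bound : ∀ f → Pebbles (symConfig f) → 2 ^ suc h + cPeb f ≤ 3 * nPeb f
  pebbling-bound f pebbles with pebbles leftmostLeaf
  ... | c , reachable , 1≤cℓ = *-cancelˡ-≤ (2 ^ h) {{m^n≢0 2 h}} (begin
    2 ^ h * (2 ^ suc h + cPeb f)                 ≡⟨ expand (2 ^ h) (cPeb f) ⟩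
    2 * (2 ^ h * 2 ^ h) + 2 ^ h * cPeb f         ≡⟨ cong (λ x → 2 * x + 2 ^ h * cPeb f)
                                                         (sym (^-distribʳ-* 2 2 h)) ⟩
    2 * 4 ^ h + 2 ^ h * cPeb f                   ≤⟨ +-monoˡ-≤ (2 ^ h * cPeb f) (*-monoʳ-≤ 2
                                                      (≤-trans (potential-leftmostLeaf c 1≤cℓ)
                                                               (potential-reachable reachable))) ⟩
    2 * potential (symConfig f) + 2 ^ h * cPeb f ≡⟨ potential-symConfig f ⟩
    3 * 2 ^ h * nPeb f                           ≡⟨ commute (2 ^ h) (nPeb f) ⟩
    2 ^ h * (3 * nPeb f)                         ∎)
    where
    open ≤-Reasoning
    expand : ∀ P C → P * (2 * P + C) ≡ 2 * (P * P) + P * C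
    expand = solve-∀
    commute : ∀ P N → 3 * P * N ≡ P * (3 * N)
    commute = solve-∀

lemma4p2 : (h : ℕ) → 1 ≤ h → (f : Fin (suc h) → ℕ) →
    EvenSym f → Pebbles (symConfig f) →
    2 ^ suc h ≤ 3 * nPeb f ∸ cPeb f
lemma4p2 h _ f _ pebbles = m+n≤o⇒m≤o∸n (2 ^ suc h) (Potential.pebbling-bound h f pebbles)
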